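{- Let $a,d,k\in\mathbb{N}$ with $k\le a$, and suppose $S=\langle a,\ a+d,\ a+2d,\ \dots,\ a+(k-1)d\rangle$ is a numerical semigroup, with genus $g=g(S)$. Then $S$ is reflective if and only if one of the following occurs: (1) $S=\langle 1\rangle$; here $g=0$, $a=1$, $k=1$, and $d$ is arbitrary. (2) $S=\langle 2,2g+1\rangle$ with $g\equiv1\pmod 2$; here $a=2$, $k=2$, $d=2g-1$. (3) $S=\langle 3,g+1\rangle$ with $g\equiv1\pmod3$; here $a=3$, $k=2$, $d=g-2$. (4) $S=\langle 3,g+2,2g+1\rangle$ with $g\equiv 2\pmod 3$; here $a=3$, $k=3$, $d=g-1$. (5) $S=\langle\{g+1,g+2,\dots,2g+1\}\rangle$ for some $g\ge0$; here $a=g+1$, $k=g+1$, $d=1$.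
   Context: A numerical semigroup is a submonoid $S$ of $(\mathbb{N}_0,+)$ with finite complement; $g(S)=\#(\mathbb{N}_0\setminus S)$. $\langle a_1,\dots,a_k\rangle$ denotes the set of all $\mathbb{N}_0$-linear combinations of $a_1,\dots,a_k$. A numerical semigroup $S$ of genus $g\ge1$ is reflective if for every integer $z$ with $0\le z\le g-1$ exactly one of $z$ and $z+g$ lies in $S$; by convention $\mathbb{N}_0$ (genus $0$) is (vacuously) reflective. -}

module Defs where

open import Data.Nat using (ℕ; zero; suc; _+_; _*_; _≤_; _<_)
open import Data.List using (List; map; upTo; length)
open import Data.List.Membership.Propositional using (_∈_)
open import Data.List.Relation.Unary.Unique.Propositional using (Unique)
open import Data.Product using (Σ; ∃; _×_)
open import Data.Sum using (_⊎_)
open import Relation.Nullary using (¬_)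
open import Function.Bundles using (_⇔_)
open import Relation.Binary.PropositionalEquality using (_≡_)

Subset : Set₁
Subset = ℕ → Set

data _∈⟨_⟩ : ℕ → List ℕ → Set where
  zero∈ : ∀ {gs} → 0 ∈⟨ gs ⟩
  add∈  : ∀ {gs g n} → g ∈ gs → n ∈⟨ gs ⟩ → (g + n) ∈⟨ gs ⟩

⟨_⟩ : List ℕ → Subset
⟨ gs ⟩ n = n ∈⟨ gs ⟩

_≐_ : Subset → Subset → Set
S ≐ T = ∀ n → S n ⇔ T n

-- S has finite complement in ℕ₀ (so a submonoid S is a numerical semigroup).
FiniteComplement : Subset → Set
FiniteComplement S = ∃ λ N → ∀ n → N ≤ n → S n

HasGenus : Subset → ℕ → Set
HasGenus S g = Σ (List ℕ) λ L →
  Unique L × length L ≡ g × (∀ n → (n ∈ L) ⇔ (¬ S n))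

-- Reflective (S of genus g): for every 0 ≤ z ≤ g-1 exactly one of z, z+g lies
-- in S.  (For g = 0 this is vacuous, matching the convention for ℕ₀.)
Reflective : Subset → ℕ → Set
Reflective S g = ∀ z → z < g →
  (S z × ¬ S (z + g)) ⊎ (¬ S z × S (z + g))

apGens : ℕ → ℕ → ℕ → List ℕ
apGens a d k = map (λ i → a + i * d) (upTo k)

-- Reflectivity gives, for each z < g, a gap among z and z + g: g distinct gaps below 2g, so by
-- the genus every x ≥ 2g lies in S.  For S = ⟨a, a + d, …, a + (k-1)d⟩ with k ≥ 2 the gaps
-- 1, …, a - 1 then force a ≤ g + 1.  If a = g + 1, every number above g lies in S, which pins
-- down d = 1 and k = a.  Otherwise a < g < a + d, so 1 + g, 2 + g, 3 + g are elements of S below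
-- 2a + d, where S contains only multiples of a and the generators a + i d: for a ≥ 4 they cannot
-- fit, and for a = 2, 3 the residue of g modulo a determines d and k.  Conversely the five
-- families are reflective by a residue computation, after identifying g with the evident genus
-- of ⟨1⟩ and of the interval semigroup.

module Submission where

open import Defs

open import Data.Empty using (⊥; ⊥-elim)
open import Data.List using (List; []; _∷_; map; upTo; length)
open import Data.List.Membership.Propositional using (_∈_)
open import Data.List.Membership.Propositional.Properties using (∈-map⁺; ∈-map⁻; ∈-upTo⁺; ∈-upTo⁻)
open import Data.List.Properties using (length-removeAt′; map-cong; length-map; length-upTo)
open import Data.List.Relation.Unary.All as All using (All; []; _∷_)
open import Data.List.Relation.Unary.AllPairs using ([]; _∷_)
open import Data.List.Relation.Unary.Any using (here; there; _─_)
open import Data.List.Relation.Unary.Unique.Propositional using (Unique)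
import Data.List.Relation.Unary.Unique.Propositional.Properties as Unique
open import Data.Nat
  using (ℕ; zero; suc; _+_; _*_; _∸_; _≤_; _<_; _%_; _/_; z≤n; s≤s; s≤s⁻¹; NonZero; >-nonZero; _≤?_; _<?_; _≟_)
open import Data.Nat.DivMod using (m≡m%n+[m/n]*n; [m+kn]%n≡m%n; m<n⇒m%n≡m)
open import Data.Nat.Divisibility using (_∣_; divides; ∣-refl; ∣⇒≤; ∣m+n∣m⇒∣n; ∣m∣n⇒∣m+n; ∣n⇒∣m*n; ∣1⇒≡1)
open import Data.Nat.Induction using (<-rec)
open import Data.Nat.Properties
open import Algebra.Properties.CommutativeSemigroup +-commutativeSemigroup using (x∙yz≈y∙xz)
open import Data.Nat.Tactic.RingSolver using (solve-∀)
open import Data.Product using (_×_; ∃; ∃₂; Σ; _,_; proj₁; proj₂; map₁)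
open import Data.Sum using (_⊎_; inj₁; inj₂; [_,_]′)
open import Function.Bundles using (_⇔_; mk⇔; Equivalence)
open import Relation.Binary.PropositionalEquality
open import Relation.Nullary using (¬_; yes; no)
open import Relation.Nullary.Decidable using (decidable-stable)
open import Relation.Nullary.Negation using (¬¬-map)

∈⟨⟩-+ : ∀ {gs x y} → x ∈⟨ gs ⟩ → y ∈⟨ gs ⟩ → (x + y) ∈⟨ gs ⟩
∈⟨⟩-+ zero∈ y∈ = y∈
∈⟨⟩-+ {gs} {y = y} (add∈ {g = g} {n = n} g∈ n∈) y∈ =
  subst (_∈⟨ gs ⟩) (sym (+-assoc g n y)) (add∈ g∈ (∈⟨⟩-+ n∈ y∈))

∈⟨⟩-gen : ∀ {gs g} → g ∈ gs → g ∈⟨ gs ⟩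
∈⟨⟩-gen {gs} {g} g∈ = subst (_∈⟨ gs ⟩) (+-identityʳ g) (add∈ g∈ zero∈)

∈⟨⟩-* : ∀ {gs g} → g ∈ gs → ∀ j → (j * g) ∈⟨ gs ⟩
∈⟨⟩-* g∈ zero    = zero∈
∈⟨⟩-* g∈ (suc j) = add∈ g∈ (∈⟨⟩-* g∈ j)

∈⟨⟩⇒≡0⊎≥ : ∀ {gs c n} → (∀ {g} → g ∈ gs → c ≤ g) → n ∈⟨ gs ⟩ → n ≡ 0 ⊎ c ≤ n
∈⟨⟩⇒≡0⊎≥ gs≥c zero∈ = inj₁ refl
∈⟨⟩⇒≡0⊎≥ gs≥c (add∈ {g = g} {n = n} g∈ _) = inj₂ (≤-trans (gs≥c g∈) (m≤m+n g n))

∈⟨⟩-∣ : ∀ {gs p n} → (∀ {g} → g ∈ gs → p ∣ g) → n ∈⟨ gs ⟩ → p ∣ n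
∈⟨⟩-∣ p∣gs zero∈ = divides 0 refl
∈⟨⟩-∣ p∣gs (add∈ g∈ n∈) = ∣m∣n⇒∣m+n (p∣gs g∈) (∈⟨⟩-∣ p∣gs n∈)

∈⟨⟩-<⇒∣ : ∀ {gs p c n} → (∀ {g} → g ∈ gs → g ≡ p ⊎ c ≤ g) → n ∈⟨ gs ⟩ → n < c → p ∣ n
∈⟨⟩-<⇒∣ gs-shape zero∈ _ = divides 0 refl
∈⟨⟩-<⇒∣ gs-shape (add∈ {g = g} {n = n} g∈ n∈) g+n<c with gs-shape g∈
... | inj₁ refl =
  ∣m∣n⇒∣m+n (divides 1 (sym (+-identityʳ g))) (∈⟨⟩-<⇒∣ gs-shape n∈ (≤-<-trans (m≤n+m n g) g+n<c))
... | inj₂ c≤g  = ⊥-elim (<-irrefl refl (<-≤-trans g+n<c (≤-trans c≤g (m≤m+n g n))))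

∈⟨⟩-restrict : ∀ {gs hs b x} → (∀ {g} → g ∈ gs → g ≤ b → g ∈ hs) → x ∈⟨ gs ⟩ → x ≤ b → x ∈⟨ hs ⟩
∈⟨⟩-restrict small-gs∈hs zero∈ _ = zero∈
∈⟨⟩-restrict small-gs∈hs (add∈ {g = g} {n = n} g∈ n∈) g+n≤b =
  add∈ (small-gs∈hs g∈ (≤-trans (m≤m+n g n) g+n≤b))
       (∈⟨⟩-restrict small-gs∈hs n∈ (≤-trans (m≤n+m n g) g+n≤b))

∈⟨[]⟩⁻ : ∀ {n} → n ∈⟨ [] ⟩ → n ≡ 0
∈⟨[]⟩⁻ zero∈ = refl

∈⟨∷⟩⁻ : ∀ {x gs n} → n ∈⟨ x ∷ gs ⟩ → ∃₂ λ j m → m ∈⟨ gs ⟩ × n ≡ j * x + m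
∈⟨∷⟩⁻ zero∈ = 0 , 0 , zero∈ , refl
∈⟨∷⟩⁻ {x} (add∈ (here refl) n∈) with ∈⟨∷⟩⁻ n∈
... | j , m , m∈ , refl = suc j , m , m∈ , sym (+-assoc x (j * x) m)
∈⟨∷⟩⁻ {x} (add∈ {g = g} (there g∈) n∈) with ∈⟨∷⟩⁻ n∈
... | j , m , m∈ , refl = j , g + m , add∈ g∈ m∈ , x∙yz≈y∙xz g (j * x) m

∈⟨_,_⟩⁻-< : ∀ p c {x} → x ∈⟨ p ∷ c ∷ [] ⟩ → x < 2 * c → ∃ λ j → x ≡ j * p ⊎ x ≡ j * p + c
∈⟨ p , c ⟩⁻-< x∈ x<2c with ∈⟨∷⟩⁻ x∈
... | j , m , m∈ , refl with ∈⟨∷⟩⁻ m∈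
... | t , m′ , m′∈ , refl rewrite ∈⟨[]⟩⁻ m′∈ with t
... | zero = j , inj₁ (+-identityʳ (j * p))
... | suc zero = j , inj₂ (cong (j * p +_) (trans (+-identityʳ (c + 0)) (+-identityʳ c)))
... | suc (suc t) = ⊥-elim (<⇒≱ x<2c (≤-trans (*-monoˡ-≤ c {2} {suc (suc t)} (s≤s (s≤s z≤n)))
                      (≤-trans (≤-reflexive (sym (+-identityʳ _))) (m≤n+m _ (j * p)))))

∣-gens⇒¬FiniteComplement : ∀ {gs p} → 2 ≤ p → (∀ {g} → g ∈ gs → p ∣ g) → ¬ FiniteComplement ⟨ gs ⟩
∣-gens⇒¬FiniteComplement {p = p} 2≤p p∣gs (N , ≥N⇒∈) = <-irrefl (sym (∣1⇒≡1 p∣1)) 2≤p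
  where
  p∣1 : p ∣ 1
  p∣1 = ∣m+n∣m⇒∣n (∈⟨⟩-∣ p∣gs (≥N⇒∈ (N + 1) (m≤m+n N 1))) (∈⟨⟩-∣ p∣gs (≥N⇒∈ N ≤-refl))

⟨⟩-cong : ∀ {gs hs} → gs ≡ hs → ⟨ gs ⟩ ≐ ⟨ hs ⟩
⟨⟩-cong refl n = mk⇔ (λ n∈ → n∈) (λ n∈ → n∈)

Reflective-resp-≐ : ∀ {S T g} → S ≐ T → Reflective T g → Reflective S g
Reflective-resp-≐ {g = g} S≐T reflT z z<g with reflT z z<g
... | inj₁ (z∈ , z+g∉) = inj₁ (Equivalence.from (S≐T z) z∈ , λ z+g∈ → z+g∉ (Equivalence.to (S≐T (z + g)) z+g∈))
... | inj₂ (z∉ , z+g∈) = inj₂ ((λ z∈ → z∉ (Equivalence.to (S≐T z) z∈)) , Equivalence.from (S≐T (z + g)) z+g∈)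

∈-─ : ∀ {A : Set} {x y : A} {ys} (x∈ : x ∈ ys) → y ∈ ys → y ≢ x → y ∈ (ys ─ x∈)
∈-─ (here refl) (here refl) y≢x = ⊥-elim (y≢x refl)
∈-─ (here refl) (there y∈) _    = y∈
∈-─ (there x∈)  (here refl) _   = here refl
∈-─ (there x∈)  (there y∈) y≢x  = there (∈-─ x∈ y∈ y≢x)

unique-⊆⇒length≤ : ∀ {A : Set} {xs ys : List A} →
  Unique xs → (∀ {x} → x ∈ xs → x ∈ ys) → length xs ≤ length ys
unique-⊆⇒length≤ {xs = []} _ _ = z≤n
unique-⊆⇒length≤ {xs = x ∷ xs} {ys} (x∉xs ∷ xs!) xs⊆ys = begin
  suc (length xs)         ≤⟨ s≤s (unique-⊆⇒length≤ xs! xs⊆ys─x) ⟩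
  suc (length (ys ─ x∈ys)) ≡⟨ length-removeAt′ ys _ ⟨
  length ys               ∎
  where
  open ≤-Reasoning
  x∈ys = xs⊆ys (here refl)
  xs⊆ys─x : ∀ {y} → y ∈ xs → y ∈ (ys ─ x∈ys)
  xs⊆ys─x y∈ = ∈-─ x∈ys (xs⊆ys (there y∈)) (λ y≡x → All.lookup x∉xs y∈ (sym y≡x))

module _ {S : Subset} {g : ℕ} (reflS : Reflective S g) where

  reflective-∈⇒∉ : ∀ {z} → z < g → S z → ¬ S (z + g)
  reflective-∈⇒∉ {z} z<g z∈ with reflS z z<g
  ... | inj₁ (_ , z+g∉) = z+g∉
  ... | inj₂ (z∉ , _)   = ⊥-elim (z∉ z∈)

  reflective-∉⇒∈ : ∀ {z} → z < g → ¬ S z → S (z + g)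
  reflective-∉⇒∈ {z} z<g z∉ with reflS z z<g
  ... | inj₁ (z∈ , _)   = ⊥-elim (z∉ z∈)
  ... | inj₂ (_ , z+g∈) = z+g∈

  -- For m ≤ g, Band m y says that y is z or z + g for some z < m.
  private
    Band : ℕ → ℕ → Set
    Band m y = y < m ⊎ (g ≤ y × y < m + g)

    band-suc : ∀ {m y} → Band m y → Band (suc m) y
    band-suc (inj₁ y<m)         = inj₁ (m<n⇒m<1+n y<m)
    band-suc (inj₂ (g≤y , y<m+g)) = inj₂ (g≤y , m<n⇒m<1+n y<m+g)

    band-≢ : ∀ {m y} → m < g → Band m y → y ≢ m × y ≢ m + g
    band-≢ {m} m<g (inj₁ y<m) = (λ { refl → <-irrefl refl y<m })
                              , (λ { refl → <-irrefl refl (<-≤-trans y<m (m≤m+n m g)) })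
    band-≢ {m} m<g (inj₂ (g≤y , y<m+g)) = (λ { refl → <-irrefl refl (<-≤-trans m<g g≤y) })
                                        , (λ { refl → <-irrefl refl y<m+g })

    band-< : ∀ {y} → Band g y → y < 2 * g
    band-< {y} b = subst (y <_) (cong (g +_) (sym (+-identityʳ g))) (y<g+g b)
      where
      y<g+g : Band g y → y < g + g
      y<g+g (inj₁ y<g)     = <-≤-trans y<g (m≤m+n g g)
      y<g+g (inj₂ (_ , y<)) = y<

    gapsBelow : ∀ m → m ≤ g → Σ (List ℕ) λ G → Unique G × length G ≡ m × All (λ y → ¬ S y × Band m y) G
    gapsBelow zero _ = [] , [] , refl , []
    gapsBelow (suc m) m<g with gapsBelow m (<⇒≤ m<g) | reflS m m<g
    ... | G , G! , refl , G-gaps | inj₁ (_ , m+g∉) =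
      m + g ∷ G , All.map (λ (_ , b) → ≢-sym (proj₂ (band-≢ m<g b))) G-gaps ∷ G! , refl ,
      (m+g∉ , inj₂ (m≤n+m g m , ≤-refl)) ∷ All.map (λ (y∉ , b) → y∉ , band-suc b) G-gaps
    ... | G , G! , refl , G-gaps | inj₂ (m∉ , _) =
      m ∷ G , All.map (λ (_ , b) → ≢-sym (proj₁ (band-≢ m<g b))) G-gaps ∷ G! , refl ,
      (m∉ , inj₁ ≤-refl) ∷ All.map (λ (y∉ , b) → y∉ , band-suc b) G-gaps

  reflective⇒2g≤⇒∈ : HasGenus S g → ∀ x → 2 * g ≤ x → ¬ ¬ S x
  reflective⇒2g≤⇒∈ (L , _ , |L| , L⇔gap) x 2g≤x x∉ with gapsBelow g ≤-refl
  ... | G , G! , |G| , G-gaps = <-irrefl refl (begin-strict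
    g                  ≡⟨ |G| ⟨
    length G           <⟨ n<1+n (length G) ⟩
    length (x ∷ G)     ≤⟨ unique-⊆⇒length≤ xG! xG⊆L ⟩
    length L           ≡⟨ |L| ⟩
    g                  ∎)
    where
    open ≤-Reasoning
    xG! : Unique (x ∷ G)
    xG! = All.map (λ (_ , b) x≡y → <-irrefl refl (≤-trans (band-< b) (subst (2 * g ≤_) x≡y 2g≤x))) G-gaps ∷ G!
    xG⊆L : ∀ {y} → y ∈ x ∷ G → y ∈ L
    xG⊆L (here refl) = Equivalence.from (L⇔gap x) x∉
    xG⊆L {y} (there y∈) = Equivalence.from (L⇔gap y) (proj₁ (All.lookup G-gaps y∈))

apGens-∈ : ∀ {a d k i} → i < k → (a + i * d) ∈ apGens a d k
apGens-∈ {a} {d} i<k = ∈-map⁺ (λ i → a + i * d) (∈-upTo⁺ i<k)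

apGens-∈⁻ : ∀ {a d k x} → x ∈ apGens a d k → ∃ λ i → i < k × x ≡ a + i * d
apGens-∈⁻ {a} {d} {k} x∈ with ∈-map⁻ (λ i → a + i * d) {xs = upTo k} x∈
... | i , i∈ , x≡ = i , ∈-upTo⁻ i∈ , x≡

∈⟨apGens⟩⁻ : ∀ {a d n x} → x ∈⟨ apGens a d (suc n) ⟩ → ∃₂ λ j i → i ≤ j * n × x ≡ j * a + i * d
∈⟨apGens⟩⁻ zero∈ = 0 , 0 , z≤n , refl
∈⟨apGens⟩⁻ {a} {d} (add∈ g∈ x∈) with apGens-∈⁻ g∈ | ∈⟨apGens⟩⁻ x∈
... | i₀ , s≤s i₀≤n , refl | j , i , i≤jn , refl =
  suc j , i₀ + i , +-mono-≤ i₀≤n i≤jn , shift a i₀ d j i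
  where
  shift : ∀ a i₀ d j i → a + i₀ * d + (j * a + i * d) ≡ suc j * a + (i₀ + i) * d
  shift = solve-∀

∈⟨apGens⟩⁻-< : ∀ {a d n x} → x ∈⟨ apGens a d (suc n) ⟩ → x < a + (a + d) →
  a ∣ x ⊎ ∃ λ i → 1 ≤ i × i ≤ n × x ≡ a + i * d
∈⟨apGens⟩⁻-< {a} {d} {n} x∈ x< with ∈⟨apGens⟩⁻ {a} {d} {n} x∈
... | j , zero , _ , refl = inj₁ (divides j (+-identityʳ (j * a)))
... | suc zero , suc i , i≤n , refl =
  inj₂ (suc i , s≤s z≤n , subst (suc i ≤_) (+-identityʳ n) i≤n , cong (_+ suc i * d) (+-identityʳ a))
... | suc (suc j) , suc i , _ , refl =
  ⊥-elim (<⇒≱ x< (subst (_≤ suc (suc j) * a + suc i * d) (+-assoc a a d) (+-mono-≤ a+a≤ (m≤m+n d (i * d)))))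
  where
  a+a≤ : a + a ≤ suc (suc j) * a
  a+a≤ = subst (_≤ suc (suc j) * a) (cong (a +_) (+-identityʳ a)) (*-monoˡ-≤ a {2} {suc (suc j)} (s≤s (s≤s z≤n)))

∈⟨apGens⟩⁻-∤ : ∀ {a d n x} → x ∈⟨ apGens a d (suc n) ⟩ → ¬ a ∣ x → a + d ≤ x
∈⟨apGens⟩⁻-∤ {a} {d} {n} x∈ a∤x with ∈⟨apGens⟩⁻ {a} {d} {n} x∈
... | j , zero , _ , refl = ⊥-elim (a∤x (divides j (+-identityʳ (j * a))))
... | suc j , suc i , _ , refl = +-mono-≤ (m≤m+n a (j * a)) (m≤m+n d (i * d))

remainder-unique : ∀ n {r r′} q q′ .{{_ : NonZero n}} → r < n → r′ < n → r + q * n ≡ r′ + q′ * n → r ≡ r′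
remainder-unique n {r} {r′} q q′ r<n r′<n eq = begin
  r               ≡⟨ m<n⇒m%n≡m r<n ⟨
  r % n           ≡⟨ [m+kn]%n≡m%n r q n ⟨
  (r + q * n) % n ≡⟨ cong (_% n) eq ⟩
  (r′ + q′ * n) % n ≡⟨ [m+kn]%n≡m%n r′ q′ n ⟩
  r′ % n          ≡⟨ m<n⇒m%n≡m r′<n ⟩
  r′              ∎
  where open ≡-Reasoning

∤-remainder : ∀ p {r} q .{{_ : NonZero p}} → 0 < r → r < p → ¬ p ∣ r + q * p
∤-remainder p q 0<r r<p (divides j eq) with remainder-unique p q j r<p (≤-<-trans z≤n r<p) eq
... | refl = <-irrefl refl 0<r

m≡r+q*n⇒m%n≡r%n : ∀ {m} n r q .{{_ : NonZero n}} → m ≡ r + q * n → m % n ≡ r % n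
m≡r+q*n⇒m%n≡r%n n r q refl = [m+kn]%n≡m%n r q n

m%n≡r⇒m≡r+[m/n]*n : ∀ m n {r} .{{_ : NonZero n}} → m % n ≡ r → m ≡ r + m / n * n
m%n≡r⇒m≡r+[m/n]*n m n m%n≡r = trans (m≡m%n+[m/n]*n m n) (cong (_+ m / n * n) m%n≡r)

z+g<2g+1 : ∀ {z g} → z < g → z + g < 2 * g + 1
z+g<2g+1 {z} {g} z<g = begin-strict
  z + g      <⟨ +-monoˡ-< g z<g ⟩
  g + g      ≡⟨ cong (g +_) (+-identityʳ g) ⟨
  2 * g      <⟨ m<m+n (2 * g) (s≤s z≤n) ⟩
  2 * g + 1  ∎
  where open ≤-Reasoning

even⊎odd : ∀ n → ∃ λ q → n ≡ q * 2 ⊎ n ≡ 1 + q * 2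
even⊎odd zero = 0 , inj₁ refl
even⊎odd (suc n) with even⊎odd n
... | q , inj₁ refl = q , inj₂ refl
... | q , inj₂ refl = suc q , inj₁ refl

residue₃ : ∀ n → ∃ λ q → n ≡ q * 3 ⊎ n ≡ 1 + q * 3 ⊎ n ≡ 2 + q * 3
residue₃ zero = 0 , inj₁ refl
residue₃ (suc n) with residue₃ n
... | q , inj₁ refl        = q , inj₂ (inj₁ refl)
... | q , inj₂ (inj₁ refl) = q , inj₂ (inj₂ refl)
... | q , inj₂ (inj₂ refl) = suc q , inj₁ refl

module ReflectiveAP {a d n g : ℕ} (1≤n : 1 ≤ n) (n<a : n < a)
  (fc : FiniteComplement ⟨ apGens a d (suc n) ⟩)
  (genus : HasGenus ⟨ apGens a d (suc n) ⟩ g)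
  (reflS : Reflective ⟨ apGens a d (suc n) ⟩ g) where

  S : Subset
  S = ⟨ apGens a d (suc n) ⟩

  2≤a : 2 ≤ a
  2≤a = ≤-<-trans 1≤n n<a

  no-common-divisor : ∀ {p} → 2 ≤ p → p ∣ a → p ∣ d → ⊥
  no-common-divisor 2≤p p∣a p∣d = ∣-gens⇒¬FiniteComplement 2≤p p∣gens fc
    where
    p∣gens : ∀ {x} → x ∈ apGens a d (suc n) → _ ∣ x
    p∣gens x∈ with apGens-∈⁻ x∈
    ... | i , _ , refl = ∣m∣n⇒∣m+n p∣a (∣n⇒∣m*n i p∣d)

  a≤gens : ∀ {x} → x ∈ apGens a d (suc n) → a ≤ x
  a≤gens x∈ with apGens-∈⁻ x∈
  ... | i , _ , refl = m≤m+n a (i * d)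

  gap-<a : ∀ {z} → 0 < z → z < a → ¬ S z
  gap-<a 0<z z<a z∈ with ∈⟨⟩⇒≡0⊎≥ a≤gens z∈
  ... | inj₁ refl = <-irrefl refl 0<z
  ... | inj₂ a≤z  = <⇒≱ z<a a≤z

  a∈ : S a
  a∈ = subst S (+-identityʳ a) (∈⟨⟩-gen (apGens-∈ {a} {d} {i = 0} (s≤s z≤n)))

  a+d∈ : S (a + d)
  a+d∈ = subst (λ x → S (a + x)) (+-identityʳ d) (∈⟨⟩-gen (apGens-∈ {a} {d} {i = 1} (s≤s 1≤n)))

  2g≤⇒∈ : ∀ x → 2 * g ≤ x → ¬ ¬ S x
  2g≤⇒∈ = reflective⇒2g≤⇒∈ reflS genus

  0<g : 0 < g
  0<g with 0 <? g
  ... | yes 0<g = 0<g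
  ... | no 0≮g = ⊥-elim (2g≤⇒∈ 1 2g≤1 (gap-<a ≤-refl 2≤a))
    where
    2g≤1 : 2 * g ≤ 1
    2g≤1 = subst (λ m → 2 * m ≤ 1) (sym (n≤0⇒n≡0 (≮⇒≥ 0≮g))) z≤n

  g∉ : ¬ S g
  g∉ = reflective-∈⇒∉ reflS 0<g zero∈

  1+g∈ : ¬ ¬ S (1 + g)
  1+g∈ with 1 <? g
  ... | yes 1<g = λ 1+g∉ → 1+g∉ (reflective-∉⇒∈ reflS 1<g (gap-<a ≤-refl 2≤a))
  ... | no 1≮g = 2g≤⇒∈ (1 + g) (subst (λ m → 2 * m ≤ 1 + m) (≤-antisym 0<g (≮⇒≥ 1≮g)) ≤-refl)

  a≤1+g : a ≤ 1 + g
  a≤1+g = decidable-stable (a ≤? 1 + g) (¬¬-map a≤nonzero 1+g∈)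
    where
    a≤nonzero : ∀ {x} → S (suc x) → a ≤ suc x
    a≤nonzero x∈ with ∈⟨⟩⇒≡0⊎≥ a≤gens x∈
    ... | inj₂ a≤x = a≤x

  a+y∈⁻ : ∀ {y} → 0 < y → y < a → S (a + y) → ∃ λ i → i ≤ n × y ≡ i * d
  a+y∈⁻ {y} 0<y y<a a+y∈ with ∈⟨apGens⟩⁻-< {a} {d} {n} a+y∈ (+-monoʳ-< a (<-≤-trans y<a (m≤m+n a d)))
  ... | inj₁ a∣a+y = ⊥-elim (<⇒≱ y<a (∣⇒≤ (∣m+n∣m⇒∣n a∣a+y ∣-refl)))
    where instance _ = >-nonZero 0<y
  ... | inj₂ (i , _ , i≤n , eq) = i , i≤n , +-cancelˡ-≡ a y (i * d) eq

  module _ (a≡1+g : a ≡ suc g) where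

    g<⇒∈ : ∀ x → g < x → ¬ ¬ S x
    g<⇒∈ x g<x with 2 * g ≤? x
    ... | yes 2g≤x = 2g≤⇒∈ x 2g≤x
    ... | no 2g≰x = λ x∉ →
      x∉ (subst S (m∸n+n≡m (<⇒≤ g<x)) (reflective-∉⇒∈ reflS x∸g<g (gap-<a 0<x∸g x∸g<a)))
      where
      0<x∸g : 0 < x ∸ g
      0<x∸g = m<n⇒0<n∸m g<x
      x∸g<g : x ∸ g < g
      x∸g<g = +-cancelʳ-< g (x ∸ g) g
        (subst₂ _<_ (sym (m∸n+n≡m (<⇒≤ g<x))) (cong (g +_) (+-identityʳ g)) (≰⇒> 2g≰x))
      x∸g<a : x ∸ g < a
      x∸g<a = subst (x ∸ g <_) (sym a≡1+g) (m<n⇒m<1+n x∸g<g)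

    g<a : g < a
    g<a = subst (g <_) (sym a≡1+g) ≤-refl

    d≡1 : d ≡ 1
    d≡1 = decidable-stable (d ≟ 1) (¬¬-map a+1∈⇒d≡1 (g<⇒∈ (a + 1) (<-≤-trans g<a (m≤m+n a 1))))
      where
      a+1∈⇒d≡1 : S (a + 1) → d ≡ 1
      a+1∈⇒d≡1 a+1∈ with a+y∈⁻ ≤-refl 2≤a a+1∈
      ... | i , _ , 1≡id = m*n≡1⇒n≡1 i d (sym 1≡id)

    n≡g : n ≡ g
    n≡g = ≤-antisym (s≤s⁻¹ (subst (n <_) a≡1+g n<a))
      (decidable-stable (g ≤? n) (¬¬-map a+g∈⇒g≤n (g<⇒∈ (a + g) (<-≤-trans g<a (m≤m+n a g)))))
      where
      a+g∈⇒g≤n : S (a + g) → g ≤ n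
      a+g∈⇒g≤n a+g∈ with a+y∈⁻ 0<g g<a a+g∈
      ... | i , i≤n , g≡id = subst (_≤ n) (sym (trans g≡id (trans (cong (i *_) d≡1) (*-identityʳ i)))) i≤n

  d∉ : ¬ S d
  d∉ d∈ with ∈⟨apGens⟩⁻ {a} {d} {n} d∈
  ... | j , zero , _ , d≡ = no-common-divisor 2≤a ∣-refl (divides j (trans d≡ (+-identityʳ (j * a))))
  ... | suc j , suc i , _ , d≡ =
    <⇒≱ (m<n+m d (<-trans (s≤s z≤n) 2≤a))
        (subst (a + d ≤_) (sym d≡) (+-mono-≤ (m≤m+n a (j * a)) (m≤m+n d (i * d))))

  -- Otherwise a + d < g; as d is a gap, d + g ∈ S and hence (a + d) + g ∈ S, against a + d ∈ S.
  g<a+d : g < a + d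
  g<a+d with g <? a + d
  ... | yes g<a+d = g<a+d
  ... | no g≮a+d = ⊥-elim (reflective-∈⇒∉ reflS a+d<g a+d∈ a+d+g∈)
    where
    a+d<g : a + d < g
    a+d<g = ≤∧≢⇒< (≮⇒≥ g≮a+d) (λ a+d≡g → g∉ (subst S a+d≡g a+d∈))
    a+d+g∈ : S (a + d + g)
    a+d+g∈ = subst S (sym (+-assoc a d g)) (∈⟨⟩-+ a∈ (reflective-∉⇒∈ reflS (≤-<-trans (m≤n+m d a) a+d<g) d∉))

  a≡1+g⊎a<g : a ≡ suc g ⊎ a < g
  a≡1+g⊎a<g with a ≟ suc g
  ... | yes a≡1+g = inj₁ a≡1+g
  ... | no a≢1+g = inj₂ (≤∧≢⇒< (s≤s⁻¹ (≤∧≢⇒< a≤1+g a≢1+g)) (λ a≡g → g∉ (subst S a≡g a∈)))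

module _ {d g : ℕ}
  (fc : FiniteComplement ⟨ apGens 2 d 2 ⟩)
  (genus : HasGenus ⟨ apGens 2 d 2 ⟩ g)
  (reflS : Reflective ⟨ apGens 2 d 2 ⟩ g) where

  open ReflectiveAP {2} {d} {1} {g} ≤-refl ≤-refl fc genus reflS

  private
    g-odd : ∃ λ q → g ≡ 1 + q * 2
    g-odd with even⊎odd g
    ... | q , inj₁ g≡2q = ⊥-elim (g∉ (subst S (sym g≡2q) (∈⟨⟩-* (here refl) q)))
    ... | q , inj₂ g≡1+2q = q , g≡1+2q

    d-odd : ∃ λ e → d ≡ 1 + e * 2
    d-odd with even⊎odd d
    ... | e , inj₁ d≡2e = ⊥-elim (no-common-divisor ≤-refl ∣-refl (divides e d≡2e))
    ... | e , inj₂ d≡1+2e = e , d≡1+2e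

    2+d≤2g+1 : 2 + d ≤ 2 * g + 1
    2+d≤2g+1 = decidable-stable (2 + d ≤? 2 * g + 1)
      (¬¬-map (λ x∈ → ∈⟨apGens⟩⁻-∤ x∈ 2∤2g+1) (2g≤⇒∈ (2 * g + 1) (m≤m+n (2 * g) 1)))
      where
      2∤2g+1 : ¬ 2 ∣ 2 * g + 1
      2∤2g+1 = subst (λ x → ¬ 2 ∣ x) (sym (2g+1≡1+g2 g)) (∤-remainder 2 g (s≤s z≤n) ≤-refl)
        where
        2g+1≡1+g2 : ∀ g → 2 * g + 1 ≡ 1 + g * 2
        2g+1≡1+g2 = solve-∀

    -- If 2 + d < 2g + 1, then (g - 1) + g exceeds the generator 2 + d by an even number.
    2g+1≤2+d : 2 * g + 1 ≤ 2 + d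
    2g+1≤2+d with g-odd | d-odd | 2 * g + 1 ≤? 2 + d
    ... | _ | _ | yes 2g+1≤2+d = 2g+1≤2+d
    ... | q , g≡ | e , d≡ | no 2g+1≰2+d =
      ⊥-elim (reflective-∈⇒∉ reflS q2<g (∈⟨⟩-* (here refl) q)
        (subst S q2+g≡ (∈⟨⟩-+ a+d∈ (∈⟨⟩-* (here refl) t))))
      where
      q2<g : q * 2 < g
      q2<g = subst (q * 2 <_) (sym g≡) ≤-refl
      e<q2 : e < q * 2
      e<q2 = *-cancelʳ-< 2 e (q * 2) (+-cancelˡ-< 3 (e * 2) (q * 2 * 2)
               (subst₂ _<_ (cong (2 +_) d≡) (trans (cong (λ x → 2 * x + 1) g≡) (odd² q)) (≰⇒> 2g+1≰2+d)))
        where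
        odd² : ∀ q → 2 * (1 + q * 2) + 1 ≡ 3 + q * 2 * 2
        odd² = solve-∀
      t = q * 2 ∸ suc e
      q2+g≡ : 2 + d + t * 2 ≡ q * 2 + g
      q2+g≡ = begin
        2 + d + t * 2                     ≡⟨ cong (λ x → 2 + x + t * 2) d≡ ⟩
        2 + (1 + e * 2) + t * 2           ≡⟨ shift e t ⟩
        (suc e + t) + (1 + (suc e + t))   ≡⟨ cong (λ x → x + (1 + x)) (m+[n∸m]≡n e<q2) ⟩
        q * 2 + (1 + q * 2)               ≡⟨ cong (q * 2 +_) g≡ ⟨
        q * 2 + g                         ∎
        where
        open ≡-Reasoning
        shift : ∀ e t → 2 + (1 + e * 2) + t * 2 ≡ suc e + t + (1 + (suc e + t))
        shift = solve-∀

  reflective⇒apGens-2-2≡ : apGens 2 d 2 ≡ 2 ∷ 2 * g + 1 ∷ [] × g % 2 ≡ 1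
  reflective⇒apGens-2-2≡ =
    cong (λ x → 2 ∷ x ∷ []) (trans (cong (2 +_) (*-identityˡ d)) (≤-antisym 2+d≤2g+1 2g+1≤2+d))
           , m≡r+q*n⇒m%n≡r%n 2 1 (proj₁ g-odd) (proj₂ g-odd)

module ReflectiveAP₃ {d n g : ℕ} (1≤n : 1 ≤ n) (n<3 : n < 3)
  (fc : FiniteComplement ⟨ apGens 3 d (suc n) ⟩)
  (genus : HasGenus ⟨ apGens 3 d (suc n) ⟩ g)
  (reflS : Reflective ⟨ apGens 3 d (suc n) ⟩ g)
  (3<g : 3 < g) where

  open ReflectiveAP 1≤n n<3 fc genus reflS public

  private
    d<r<2d-impossible : ∀ {r d} → r < 3 → d < r → r < 2 * d → ⊥
    d<r<2d-impossible {suc (suc (suc _))} (s≤s (s≤s (s≤s ())))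
    d<r<2d-impossible {1} {zero} _ _ ()
    d<r<2d-impossible {1} {suc _} _ (s≤s ())
    d<r<2d-impossible {2} {zero} _ _ ()
    d<r<2d-impossible {2} {suc zero} _ _ (s≤s (s≤s ()))
    d<r<2d-impossible {2} {suc (suc _)} _ (s≤s (s≤s ()))

    -- A residue r + g below 3 + (3 + d) that is not a multiple of 3 can only be 3 + d or 3 + 2d,
    -- and 3 + 2d is too large because g < 3 + d.
    r+g≡3+d : ∀ {r} → 0 < r → r < 3 → ¬ 3 ∣ r + g → r + g ≡ 3 + d
    r+g≡3+d {r} 0<r r<3 3∤r+g with ∈⟨apGens⟩⁻-< {3} {d} {n} r+g∈ r+g<
      where
      r+g∈ : S (r + g)
      r+g∈ = reflective-∉⇒∈ reflS (<-trans r<3 3<g) (gap-<a 0<r r<3)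
      r+g< : r + g < 3 + (3 + d)
      r+g< = +-mono-< r<3 g<a+d
    ... | inj₁ 3∣r+g = ⊥-elim (3∤r+g 3∣r+g)
    ... | inj₂ (1 , _ , _ , eq) = trans eq (cong (3 +_) (+-identityʳ d))
    ... | inj₂ (2 , _ , _ , eq) = ⊥-elim (d<r<2d-impossible r<3 d<r r<2d)
      where
      d<r : d < r
      d<r = +-cancelˡ-< (3 + d) d r (subst (_< 3 + d + r) (trans eq (3+2d≡ d))
              (subst (r + g <_) (+-comm r (3 + d)) (+-monoʳ-< r g<a+d)))
        where
        3+2d≡ : ∀ d → 3 + 2 * d ≡ 3 + d + d
        3+2d≡ = solve-∀
      r<2d : r < 2 * d
      r<2d = +-cancelʳ-< 3 r (2 * d) (subst (r + 3 <_) (trans eq (+-comm 3 (2 * d))) (+-monoʳ-< r 3<g))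
    ... | inj₂ (suc (suc (suc _)) , _ , i≤n , _) = ⊥-elim (<⇒≱ n<3 (≤-trans (s≤s (s≤s (s≤s z≤n))) i≤n))

  g-residue : ∃ λ q → (g ≡ 1 + q * 3 × 1 + g ≡ 3 + d) ⊎ (g ≡ 2 + q * 3 × 2 + g ≡ 3 + d)
  g-residue with residue₃ g
  ... | q , inj₁ g≡3q = ⊥-elim (g∉ (subst S (sym g≡3q) (∈⟨⟩-* (here refl) q)))
  ... | q , inj₂ (inj₁ g≡1+3q) = q , inj₁ (g≡1+3q , r+g≡3+d (s≤s z≤n) (s≤s (s≤s z≤n))
          (subst (λ x → ¬ 3 ∣ 1 + x) (sym g≡1+3q) (∤-remainder 3 q (s≤s z≤n) ≤-refl)))
  ... | q , inj₂ (inj₂ g≡2+3q) = q , inj₂ (g≡2+3q , r+g≡3+d (s≤s z≤n) ≤-refl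
          (subst (λ x → ¬ 3 ∣ 2 + x) (sym g≡2+3q) (∤-remainder 3 (suc q) (s≤s z≤n) (s≤s (s≤s z≤n)))))

module _ {d g : ℕ}
  (fc : FiniteComplement ⟨ apGens 3 d 2 ⟩)
  (genus : HasGenus ⟨ apGens 3 d 2 ⟩ g)
  (reflS : Reflective ⟨ apGens 3 d 2 ⟩ g)
  (3<g : 3 < g) where

  open ReflectiveAP₃ ≤-refl (s≤s (s≤s z≤n)) fc genus reflS 3<g

  reflective⇒apGens-3-2≡ : apGens 3 d 2 ≡ 3 ∷ g + 1 ∷ [] × g % 3 ≡ 1
  reflective⇒apGens-3-2≡ with g-residue
  ... | q , inj₁ (g≡ , 1+g≡3+d) =
    cong (λ x → 3 ∷ x ∷ []) (trans (cong (3 +_) (*-identityˡ d)) (trans (sym 1+g≡3+d) (+-comm 1 g))) ,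
    m≡r+q*n⇒m%n≡r%n 3 1 q g≡
  ... | q , inj₂ (g≡ , 2+g≡3+d) = ⊥-elim (2g≤⇒∈ (2 * g + 1) (m≤m+n (2 * g) 1) 2g+1∉)
    where
    -- With d = g - 1 the semigroup is ⟨ 3 , g + 2 ⟩, which misses 2g + 1.
    2g+1∉ : ¬ S (2 * g + 1)
    2g+1∉ 2g+1∈
      with ∈⟨ 3 , g + 2 ⟩⁻-< (subst (λ c → (2 * g + 1) ∈⟨ 3 ∷ c ∷ [] ⟩) 3+d≡g+2 2g+1∈) 2g+1<2[g+2]
      where
      3+d≡g+2 : 3 + 1 * d ≡ g + 2
      3+d≡g+2 = trans (cong (3 +_) (*-identityˡ d)) (trans (sym 2+g≡3+d) (+-comm 2 g))
      2g+1<2[g+2] : 2 * g + 1 < 2 * (g + 2)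
      2g+1<2[g+2] = subst (2 * g + 1 <_) (2g+4≡ g) (m<m+n (2 * g + 1) (s≤s z≤n))
        where
        2g+4≡ : ∀ g → 2 * g + 1 + 3 ≡ 2 * (g + 2)
        2g+4≡ = solve-∀
    ... | j , inj₁ 2g+1≡3j = ∤-remainder 3 (1 + q * 2) (s≤s z≤n) ≤-refl
            (divides j (trans (sym (trans (cong (λ x → 2 * x + 1) g≡) (odd q))) 2g+1≡3j))
      where
      odd : ∀ q → 2 * (2 + q * 3) + 1 ≡ 2 + (1 + q * 2) * 3
      odd = solve-∀
    ... | j , inj₂ 2g+1≡3j+g+2 with remainder-unique 3 q j ≤-refl (s≤s (s≤s z≤n)) (trans (sym g≡) g≡1+3j)
      where
      g≡1+3j : g ≡ 1 + j * 3
      g≡1+3j = +-cancelʳ-≡ (g + 1) g (1 + j * 3) (trans (split₁ g) (trans 2g+1≡3j+g+2 (split₂ g j)))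
        where
        split₁ : ∀ g → g + (g + 1) ≡ 2 * g + 1
        split₁ = solve-∀
        split₂ : ∀ g j → j * 3 + (g + 2) ≡ 1 + j * 3 + (g + 1)
        split₂ = solve-∀
    ... | ()

module _ {d g : ℕ}
  (fc : FiniteComplement ⟨ apGens 3 d 3 ⟩)
  (genus : HasGenus ⟨ apGens 3 d 3 ⟩ g)
  (reflS : Reflective ⟨ apGens 3 d 3 ⟩ g)
  (3<g : 3 < g) where

  open ReflectiveAP₃ (s≤s z≤n) ≤-refl fc genus reflS 3<g

  private
    3+2d+3≡2[3+d] : ∀ d → 3 + 2 * d + 3 ≡ 2 * (3 + d)
    3+2d+3≡2[3+d] = solve-∀

  reflective⇒apGens-3-3≡ : apGens 3 d 3 ≡ 3 ∷ g + 2 ∷ 2 * g + 1 ∷ [] × g % 3 ≡ 2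
  reflective⇒apGens-3-3≡ with g-residue
  ... | q , inj₂ (g≡ , 2+g≡3+d) =
    cong₂ (λ x y → 3 ∷ x ∷ y ∷ []) (trans (cong (3 +_) (*-identityˡ d)) (trans (sym 2+g≡3+d) (+-comm 2 g)))
      (+-cancelʳ-≡ 3 (3 + 2 * d) (2 * g + 1) (begin
        3 + 2 * d + 3  ≡⟨ 3+2d+3≡2[3+d] d ⟩
        2 * (3 + d)    ≡⟨ cong (2 *_) 2+g≡3+d ⟨
        2 * (2 + g)    ≡⟨ 2[2+g]≡ g ⟩
        2 * g + 1 + 3  ∎)) ,
    m≡r+q*n⇒m%n≡r%n 3 2 q g≡
    where
    open ≡-Reasoning
    2[2+g]≡ : ∀ g → 2 * (2 + g) ≡ 2 * g + 1 + 3
    2[2+g]≡ = solve-∀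
  -- With d = g - 2 the last generator 3 + 2d = 2g - 1 is (g - 1) + g, and g - 1 ∈ S.
  ... | q , inj₁ (g≡ , 1+g≡3+d) =
    ⊥-elim (reflective-∈⇒∉ reflS 3q<g (∈⟨⟩-* (here refl) q)
      (subst S 3+2d≡3q+g (∈⟨⟩-gen (apGens-∈ {3} {d} {3} {2} ≤-refl))))
    where
    3q<g : q * 3 < g
    3q<g = subst (q * 3 <_) (sym g≡) ≤-refl
    3+2d≡3q+g : 3 + 2 * d ≡ q * 3 + g
    3+2d≡3q+g = +-cancelʳ-≡ 3 (3 + 2 * d) (q * 3 + g) (begin
      3 + 2 * d + 3  ≡⟨ 3+2d+3≡2[3+d] d ⟩
      2 * (3 + d)    ≡⟨ cong (2 *_) 1+g≡3+d ⟨
      2 * (1 + g)    ≡⟨ cong (λ x → 2 * (1 + x)) g≡ ⟩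
      2 * (2 + q * 3) ≡⟨ 2[2+3q]≡ q ⟩
      q * 3 + (1 + q * 3) + 3 ≡⟨ cong (λ x → q * 3 + x + 3) g≡ ⟨
      q * 3 + g + 3  ∎)
      where
      open ≡-Reasoning
      2[2+3q]≡ : ∀ q → 2 * (2 + q * 3) ≡ q * 3 + (1 + q * 3) + 3
      2[2+3q]≡ = solve-∀

module _ {a d n g : ℕ} (1≤n : 1 ≤ n) (n<a : n < a)
  (fc : FiniteComplement ⟨ apGens a d (suc n) ⟩)
  (genus : HasGenus ⟨ apGens a d (suc n) ⟩ g)
  (reflS : Reflective ⟨ apGens a d (suc n) ⟩ g)
  (3<a : 3 < a) (a<g : a < g) where

  open ReflectiveAP 1≤n n<a fc genus reflS

  private
    Progression : ℕ → Set
    Progression x = ∃ λ i → x ≡ a + i * d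

    z+g∈ : ∀ {z} → 0 < z → z ≤ 3 → a ∣ z + g ⊎ Progression (z + g)
    z+g∈ {z} 0<z z≤3 with ∈⟨apGens⟩⁻-< {a} {d} {n} z+g∈S z+g<
      where
      z<a : z < a
      z<a = ≤-<-trans z≤3 3<a
      z+g∈S : S (z + g)
      z+g∈S = reflective-∉⇒∈ reflS (<-trans z<a a<g) (gap-<a 0<z z<a)
      z+g< : z + g < a + (a + d)
      z+g< = +-mono-≤-< (<⇒≤ z<a) g<a+d
    ... | inj₁ a∣z+g = inj₁ a∣z+g
    ... | inj₂ (i , _ , _ , eq) = inj₂ (i , eq)

    multiples-apart : ∀ {x c} → 0 < c → c < a → a ∣ x → ¬ a ∣ c + x
    multiples-apart {x} {c} 0<c c<a a∣x a∣c+x =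
      <⇒≱ c<a (∣⇒≤ {{>-nonZero 0<c}} (∣m+n∣m⇒∣n (subst (a ∣_) (+-comm c x) a∣c+x) a∣x))

    progression-apart : ∀ {x c} → 0 < c → Progression x → Progression (c + x) → d ≤ c
    progression-apart {x} {c} 0<c (i , refl) (i′ , c+x≡) =
      d≤c (+-cancelˡ-≡ a (c + i * d) (i′ * d) (trans (x∙yz≈y∙xz a c (i * d)) c+x≡))
      where
      d≤c : c + i * d ≡ i′ * d → d ≤ c
      d≤c c+id≡i′d with i′ ≤? i
      ... | yes i′≤i = ⊥-elim (<⇒≱ (<-≤-trans (m<n+m (i * d) 0<c) (≤-reflexive c+id≡i′d)) (*-monoˡ-≤ d i′≤i))
      ... | no i′≰i = +-cancelʳ-≤ (i * d) d c (≤-trans (*-monoˡ-≤ d (≰⇒> i′≰i)) (≤-reflexive (sym c+id≡i′d)))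

    2≤d : 2 ≤ d
    2≤d = ≤∧≢⇒< (≤∧≢⇒< z≤n (≢-sym d≢0)) (≢-sym d≢1)
      where
      d≢0 : d ≢ 0
      d≢0 d≡0 = no-common-divisor 2≤a ∣-refl (divides 0 d≡0)
      d≢1 : d ≢ 1
      d≢1 d≡1 = <⇒≱ a<g (s≤s⁻¹ (subst (g <_) (trans (cong (a +_) d≡1) (+-comm a 1)) g<a+d))

  -- Of 1 + g, 2 + g, 3 + g, two neighbours cannot both be multiples of a (as a > 3) nor both lie
  -- in the progression (as d ≥ 2); the remaining pattern forces d = 2, g = a + 1 and a ∣ 3.
  3<a<g-impossible : ⊥
  3<a<g-impossible
    with z+g∈ {1} ≤-refl (s≤s z≤n) | z+g∈ {2} (s≤s z≤n) (s≤s (s≤s z≤n)) | z+g∈ {3} (s≤s z≤n) ≤-refl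
  ... | inj₂ p₁ | inj₂ p₂ | _ = <⇒≱ 2≤d (progression-apart ≤-refl p₁ p₂)
  ... | _ | inj₂ p₂ | inj₂ p₃ = <⇒≱ 2≤d (progression-apart ≤-refl p₂ p₃)
  ... | inj₁ m₁ | inj₁ m₂ | _ = multiples-apart ≤-refl (<-trans (s≤s (s≤s z≤n)) 3<a) m₁ m₂
  ... | _ | inj₁ m₂ | inj₁ m₃ = multiples-apart ≤-refl (<-trans (s≤s (s≤s z≤n)) 3<a) m₂ m₃
  ... | inj₁ m₁ | inj₂ _ | inj₁ m₃ = multiples-apart (s≤s z≤n) (<-trans (s≤s (s≤s (s≤s z≤n))) 3<a) m₁ m₃
  ... | inj₂ p₁ | inj₁ m₂ | inj₂ p₃ =
    multiples-apart (s≤s z≤n) 3<a ∣-refl (subst (a ∣_) (cong (2 +_) g≡1+a) m₂)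
    where
    d≡2 : d ≡ 2
    d≡2 = ≤-antisym (progression-apart (s≤s z≤n) p₁ p₃) 2≤d
    g≡1+a : g ≡ suc a
    g≡1+a = ≤-antisym (s≤s⁻¹ (subst (g <_) (trans (cong (a +_) d≡2) (+-comm a 2)) g<a+d)) a<g

intervalGens : ℕ → List ℕ
intervalGens h = map (λ i → h + 1 + i) (upTo (h + 1))

ReflectiveForm : Subset → ℕ → Set
ReflectiveForm S g =
    (S ≐ ⟨ 1 ∷ [] ⟩)
  ⊎ ((S ≐ ⟨ 2 ∷ 2 * g + 1 ∷ [] ⟩) × g % 2 ≡ 1)
  ⊎ ((S ≐ ⟨ 3 ∷ g + 1 ∷ [] ⟩) × g % 3 ≡ 1)
  ⊎ ((S ≐ ⟨ 3 ∷ g + 2 ∷ 2 * g + 1 ∷ [] ⟩) × g % 3 ≡ 2)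
  ⊎ (∃ λ h → S ≐ ⟨ intervalGens h ⟩)

apGens-interval : ∀ h → apGens (suc h) 1 (suc h) ≡ intervalGens h
apGens-interval h rewrite +-comm h 1 = map-cong (λ i → cong (suc h +_) (*-identityʳ i)) (upTo (suc h))

private
  reflective-apGens⇒form-a<g : ∀ {a d n g} → 1 ≤ n → n < a →
    FiniteComplement ⟨ apGens a d (suc n) ⟩ → HasGenus ⟨ apGens a d (suc n) ⟩ g →
    Reflective ⟨ apGens a d (suc n) ⟩ g → a < g → ReflectiveForm ⟨ apGens a d (suc n) ⟩ g
  reflective-apGens⇒form-a<g {0} _ () _ _ _ _
  reflective-apGens⇒form-a<g {1} {n = 0} () _ _ _ _ _
  reflective-apGens⇒form-a<g {1} {n = suc _} _ (s≤s ()) _ _ _ _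
  reflective-apGens⇒form-a<g {2} {n = 1} _ _ fc genus reflS _ =
    inj₂ (inj₁ (map₁ ⟨⟩-cong (reflective⇒apGens-2-2≡ fc genus reflS)))
  reflective-apGens⇒form-a<g {2} {n = suc (suc _)} _ (s≤s (s≤s ())) _ _ _ _
  reflective-apGens⇒form-a<g {3} {n = 1} _ _ fc genus reflS 3<g =
    inj₂ (inj₂ (inj₁ (map₁ ⟨⟩-cong (reflective⇒apGens-3-2≡ fc genus reflS 3<g))))
  reflective-apGens⇒form-a<g {3} {n = 2} _ _ fc genus reflS 3<g =
    inj₂ (inj₂ (inj₂ (inj₁ (map₁ ⟨⟩-cong (reflective⇒apGens-3-3≡ fc genus reflS 3<g)))))
  reflective-apGens⇒form-a<g {3} {n = suc (suc (suc _))} _ (s≤s (s≤s (s≤s ()))) _ _ _ _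
  reflective-apGens⇒form-a<g {suc (suc (suc (suc _)))} 1≤n n<a fc genus reflS a<g =
    ⊥-elim (3<a<g-impossible 1≤n n<a fc genus reflS (s≤s (s≤s (s≤s (s≤s z≤n)))) a<g)

  interval-form : ∀ {a d n g} → a ≡ suc g → d ≡ 1 → n ≡ g → ⟨ apGens a d (suc n) ⟩ ≐ ⟨ intervalGens g ⟩
  interval-form {g = g} refl refl refl = ⟨⟩-cong (apGens-interval g)

reflective-apGens⇒form : ∀ {a d k g} → k ≤ a →
  FiniteComplement ⟨ apGens a d k ⟩ → HasGenus ⟨ apGens a d k ⟩ g →
  Reflective ⟨ apGens a d k ⟩ g → ReflectiveForm ⟨ apGens a d k ⟩ g
reflective-apGens⇒form {k = 0} _ (N , ≥N⇒∈) _ _ with ∈⟨[]⟩⁻ (≥N⇒∈ (suc N) (n≤1+n N))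
... | ()
reflective-apGens⇒form {1} {k = 1} _ _ _ _ = inj₁ (⟨⟩-cong refl)
reflective-apGens⇒form {suc (suc _)} {k = 1} _ fc _ _ =
  ⊥-elim (∣-gens⇒¬FiniteComplement (s≤s (s≤s z≤n)) (λ { (here refl) → divides 1 refl }) fc)
reflective-apGens⇒form {a} {d} {suc (suc n)} {g} k≤a fc genus reflS =
  [ (λ a≡1+g → inj₂ (inj₂ (inj₂ (inj₂ (g , interval-form a≡1+g (d≡1 a≡1+g) (n≡g a≡1+g))))))
  , reflective-apGens⇒form-a<g (s≤s z≤n) k≤a fc genus reflS
  ]′ a≡1+g⊎a<g
  where open ReflectiveAP (s≤s z≤n) k≤a fc genus reflS

module _ {g : ℕ} (g%2≡1 : g % 2 ≡ 1) where

  private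
    T : Subset
    T = ⟨ 2 ∷ 2 * g + 1 ∷ [] ⟩

    q = g / 2

    g≡ : g ≡ 1 + q * 2
    g≡ = m%n≡r⇒m≡r+[m/n]*n g 2 g%2≡1

    odd∉ : ∀ m → 1 + m * 2 < 2 * g + 1 → ¬ T (1 + m * 2)
    odd∉ m x<2g+1 x∈ = ∤-remainder 2 m (s≤s z≤n) ≤-refl (∈⟨⟩-<⇒∣ gens x∈ x<2g+1)
      where
      gens : ∀ {x} → x ∈ 2 ∷ 2 * g + 1 ∷ [] → x ≡ 2 ⊎ 2 * g + 1 ≤ x
      gens (here refl)         = inj₁ refl
      gens (there (here refl)) = inj₂ ≤-refl

  reflective-⟨2,2g+1⟩ : Reflective ⟨ 2 ∷ 2 * g + 1 ∷ [] ⟩ g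
  reflective-⟨2,2g+1⟩ z z<g with even⊎odd z
  ... | m , inj₁ refl =
    inj₁ (∈⟨⟩-* (here refl) m ,
          subst (λ x → ¬ T x) (sym z+g≡) (odd∉ (m + q) (subst (_< 2 * g + 1) z+g≡ (z+g<2g+1 z<g))))
    where
    z+g≡ : m * 2 + g ≡ 1 + (m + q) * 2
    z+g≡ = trans (cong (m * 2 +_) g≡) (even+odd m q)
      where
      even+odd : ∀ m q → m * 2 + (1 + q * 2) ≡ 1 + (m + q) * 2
      even+odd = solve-∀
  ... | m , inj₂ refl = inj₂ (odd∉ m (≤-<-trans (m≤m+n (1 + m * 2) g) (z+g<2g+1 z<g)) ,
                              subst T (sym z+g≡) (∈⟨⟩-* (here refl) (1 + m + q)))
    where
    z+g≡ : 1 + m * 2 + g ≡ (1 + m + q) * 2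
    z+g≡ = trans (cong (1 + m * 2 +_) g≡) (odd+odd m q)
      where
      odd+odd : ∀ m q → 1 + m * 2 + (1 + q * 2) ≡ (1 + m + q) * 2
      odd+odd = solve-∀

private
  nonmultiple-∉ : ∀ {gs c r} m → (∀ {x} → x ∈ gs → x ≡ 3 ⊎ c ≤ x) → 0 < r → r < 3 →
    r + m * 3 < c → ¬ (r + m * 3) ∈⟨ gs ⟩
  nonmultiple-∉ m gens 0<r r<3 x<c x∈ = ∤-remainder 3 m 0<r r<3 (∈⟨⟩-<⇒∣ gens x∈ x<c)

  -- m * 3 + g ≡ r (mod 3) rules out the multiples of 3, and it is too small for 2 (g + r).
  shifted-multiple-∉ : ∀ {g r} q m → g ≡ r + q * 3 → 0 < r → r < 3 → m * 3 < g →
    ¬ (m * 3 + g) ∈⟨ 3 ∷ g + r ∷ [] ⟩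
  shifted-multiple-∉ {g} {r} q m g≡ 0<r r<3 m3<g x∈ with ∈⟨ 3 , g + r ⟩⁻-< x∈ x<2[g+r]
    where
    x<2[g+r] : m * 3 + g < 2 * (g + r)
    x<2[g+r] = <-≤-trans (z+g<2g+1 m3<g)
      (subst (2 * g + 1 ≤_) (sym (*-distribˡ-+ 2 g r)) (+-monoʳ-≤ (2 * g) (≤-trans 0<r (m≤m+n r (r + 0)))))
  ... | j , inj₁ x≡3j = ∤-remainder 3 (m + q) 0<r r<3 (divides j (trans (sym x≡) x≡3j))
    where
    x≡ : m * 3 + g ≡ r + (m + q) * 3
    x≡ = trans (cong (m * 3 +_) g≡) (shuffle m r q)
      where
      shuffle : ∀ m r q → m * 3 + (r + q * 3) ≡ r + (m + q) * 3
      shuffle = solve-∀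
  ... | j , inj₂ x≡3j+g+r with remainder-unique 3 m j (s≤s z≤n) r<3
          (+-cancelʳ-≡ g (m * 3) (r + j * 3) (trans x≡3j+g+r (shuffle j g r)))
    where
    shuffle : ∀ j g r → j * 3 + (g + r) ≡ r + j * 3 + g
    shuffle = solve-∀
  ... | refl = <-irrefl refl 0<r

module _ {g : ℕ} (g%3≡1 : g % 3 ≡ 1) where

  private
    T : Subset
    T = ⟨ 3 ∷ g + 1 ∷ [] ⟩

    q = g / 3

    g≡ : g ≡ 1 + q * 3
    g≡ = m%n≡r⇒m≡r+[m/n]*n g 3 g%3≡1

    gens : ∀ {x} → x ∈ 3 ∷ g + 1 ∷ [] → x ≡ 3 ⊎ g + 1 ≤ x
    gens (here refl)         = inj₁ refl
    gens (there (here refl)) = inj₂ ≤-refl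

  reflective-⟨3,g+1⟩ : Reflective ⟨ 3 ∷ g + 1 ∷ [] ⟩ g
  reflective-⟨3,g+1⟩ z z<g with residue₃ z
  ... | m , inj₁ refl = inj₁ (∈⟨⟩-* (here refl) m , shifted-multiple-∉ q m g≡ (s≤s z≤n) (s≤s (s≤s z≤n)) z<g)
  ... | m , inj₂ (inj₁ refl) =
    inj₂ (nonmultiple-∉ m gens (s≤s z≤n) (s≤s (s≤s z≤n)) (<-≤-trans z<g (m≤m+n g 1)) ,
          subst T (shuffle g m) (∈⟨⟩-+ (∈⟨⟩-gen (there (here refl))) (∈⟨⟩-* (here refl) m)))
    where
    shuffle : ∀ g m → g + 1 + m * 3 ≡ 1 + m * 3 + g
    shuffle = solve-∀
  ... | m , inj₂ (inj₂ refl) =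
    inj₂ (nonmultiple-∉ m gens (s≤s z≤n) ≤-refl (<-≤-trans z<g (m≤m+n g 1)) ,
          subst T (sym z+g≡) (∈⟨⟩-* (here refl) (1 + m + q)))
    where
    z+g≡ : 2 + m * 3 + g ≡ (1 + m + q) * 3
    z+g≡ = trans (cong (2 + m * 3 +_) g≡) (shuffle m q)
      where
      shuffle : ∀ m q → 2 + m * 3 + (1 + q * 3) ≡ (1 + m + q) * 3
      shuffle = solve-∀

module _ {g : ℕ} (g%3≡2 : g % 3 ≡ 2) where

  private
    T : Subset
    T = ⟨ 3 ∷ g + 2 ∷ 2 * g + 1 ∷ [] ⟩

    q = g / 3

    g≡ : g ≡ 2 + q * 3
    g≡ = m%n≡r⇒m≡r+[m/n]*n g 3 g%3≡2

    g+2≤2g+1 : g + 2 ≤ 2 * g + 1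
    g+2≤2g+1 = subst (_≤ 2 * g + 1) (+-comm 2 g) (z+g<2g+1 (subst (1 <_) (sym g≡) (s≤s (s≤s z≤n))))

    gens : ∀ {x} → x ∈ 3 ∷ g + 2 ∷ 2 * g + 1 ∷ [] → x ≡ 3 ⊎ g + 2 ≤ x
    gens (here refl)                 = inj₁ refl
    gens (there (here refl))         = inj₂ ≤-refl
    gens (there (there (here refl))) = inj₂ g+2≤2g+1

    drop-2g+1 : ∀ {x} → x ∈ 3 ∷ g + 2 ∷ 2 * g + 1 ∷ [] → x ≤ 2 * g → x ∈ 3 ∷ g + 2 ∷ []
    drop-2g+1 (here refl)                 _ = here refl
    drop-2g+1 (there (here refl))         _ = there (here refl)
    drop-2g+1 (there (there (here refl))) x≤2g = ⊥-elim (m+1+n≰m (2 * g) x≤2g)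

  reflective-⟨3,g+2,2g+1⟩ : Reflective ⟨ 3 ∷ g + 2 ∷ 2 * g + 1 ∷ [] ⟩ g
  reflective-⟨3,g+2,2g+1⟩ z z<g with residue₃ z
  ... | m , inj₁ refl =
    inj₁ (∈⟨⟩-* (here refl) m , λ x∈ → shifted-multiple-∉ q m g≡ (s≤s z≤n) ≤-refl z<g
      (∈⟨⟩-restrict drop-2g+1 x∈ (s≤s⁻¹ (subst (m * 3 + g <_) (+-comm (2 * g) 1) (z+g<2g+1 z<g)))))
  ... | m , inj₂ (inj₁ refl) =
    inj₂ (nonmultiple-∉ m gens (s≤s z≤n) (s≤s (s≤s z≤n)) (<-≤-trans z<g (m≤m+n g 2)) ,
          subst T (sym z+g≡) (∈⟨⟩-* (here refl) (1 + m + q)))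
    where
    z+g≡ : 1 + m * 3 + g ≡ (1 + m + q) * 3
    z+g≡ = trans (cong (1 + m * 3 +_) g≡) (shuffle m q)
      where
      shuffle : ∀ m q → 1 + m * 3 + (2 + q * 3) ≡ (1 + m + q) * 3
      shuffle = solve-∀
  ... | m , inj₂ (inj₂ refl) =
    inj₂ (nonmultiple-∉ m gens (s≤s z≤n) ≤-refl (<-≤-trans z<g (m≤m+n g 2)) ,
          subst T (shuffle g m) (∈⟨⟩-+ (∈⟨⟩-gen (there (here refl))) (∈⟨⟩-* (here refl) m)))
    where
    shuffle : ∀ g m → g + 2 + m * 3 ≡ 2 + m * 3 + g
    shuffle = solve-∀

HasGenus-unique : ∀ {S T g g′} → S ≐ T → HasGenus S g → HasGenus T g′ → g ≡ g′
HasGenus-unique S≐T (L , L! , refl , L⇔gapS) (L′ , L′! , refl , L′⇔gapT) =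
  ≤-antisym (unique-⊆⇒length≤ L! L⊆L′) (unique-⊆⇒length≤ L′! L′⊆L)
  where
  L⊆L′ : ∀ {y} → y ∈ L → y ∈ L′
  L⊆L′ {y} y∈ =
    Equivalence.from (L′⇔gapT y) (λ y∈T → Equivalence.to (L⇔gapS y) y∈ (Equivalence.from (S≐T y) y∈T))
  L′⊆L : ∀ {y} → y ∈ L′ → y ∈ L
  L′⊆L {y} y∈ =
    Equivalence.from (L⇔gapS y) (λ y∈S → Equivalence.to (L′⇔gapT y) y∈ (Equivalence.to (S≐T y) y∈S))

genus-⟨1⟩ : HasGenus ⟨ 1 ∷ [] ⟩ 0
genus-⟨1⟩ = [] , [] , refl , λ n →
  mk⇔ (λ ()) (λ n∉ → ⊥-elim (n∉ (subst (_∈⟨ 1 ∷ [] ⟩) (*-identityʳ n) (∈⟨⟩-* (here refl) n))))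

module _ (h : ℕ) where

  private
    T : Subset
    T = ⟨ intervalGens h ⟩

    gen : ∀ {t} → t ≤ h → (h + 1 + t) ∈ intervalGens h
    gen {t} t≤h = ∈-map⁺ (λ i → h + 1 + i) (∈-upTo⁺ (subst (t <_) (+-comm 1 h) (s≤s t≤h)))

    h+1≤gens : ∀ {x} → x ∈ intervalGens h → h + 1 ≤ x
    h+1≤gens x∈ with ∈-map⁻ (λ i → h + 1 + i) {xs = upTo (h + 1)} x∈
    ... | i , _ , refl = m≤m+n (h + 1) i

    gap : ∀ {y} → 0 < y → y ≤ h → ¬ T y
    gap {y} 0<y y≤h y∈ with ∈⟨⟩⇒≡0⊎≥ h+1≤gens y∈
    ... | inj₁ refl  = <-irrefl refl 0<y
    ... | inj₂ h+1≤y = <⇒≱ (subst (y <_) (+-comm 1 h) (s≤s y≤h)) h+1≤y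

    -- Strong induction: past 2h + 1, subtract the generator h + 1.
    h+1+t∈ : ∀ t → T (h + 1 + t)
    h+1+t∈ = <-rec (λ t → T (h + 1 + t)) step
      where
      step : ∀ t → (∀ {t′} → t′ < t → T (h + 1 + t′)) → T (h + 1 + t)
      step t rec with t ≤? h
      ... | yes t≤h = ∈⟨⟩-gen (gen t≤h)
      ... | no t≰h  = subst T (cong (h + 1 +_) (m+[n∸m]≡n h+1≤t)) (∈⟨⟩-+ h+1∈ (rec t′<t))
        where
        h+1≤t : h + 1 ≤ t
        h+1≤t = subst (_≤ t) (+-comm 1 h) (≰⇒> t≰h)
        t′ = t ∸ (h + 1)
        t′<t : t′ < t
        t′<t = ∸-monoʳ-< (subst (0 <_) (+-comm 1 h) (s≤s z≤n)) h+1≤t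
        h+1∈ : T (h + 1)
        h+1∈ = subst T (+-identityʳ (h + 1)) (∈⟨⟩-gen (gen z≤n))

    h<⇒∈ : ∀ {y} → h < y → T y
    h<⇒∈ {y} h<y = subst T (m+[n∸m]≡n h+1≤y) (h+1+t∈ (y ∸ (h + 1)))
      where
      h+1≤y : h + 1 ≤ y
      h+1≤y = subst (_≤ y) (+-comm 1 h) h<y

  genus-interval : HasGenus ⟨ intervalGens h ⟩ h
  genus-interval = map suc (upTo h) , Unique.map⁺ suc-injective (Unique.upTo⁺ h) ,
    trans (length-map suc (upTo h)) (length-upTo h) , λ y → mk⇔ gap-of gap⇒∈
    where
    gap-of : ∀ {y} → y ∈ map suc (upTo h) → ¬ T y
    gap-of y∈ with ∈-map⁻ suc {xs = upTo h} y∈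
    ... | i , i∈ , refl = gap (s≤s z≤n) (∈-upTo⁻ i∈)
    gap⇒∈ : ∀ {y} → ¬ T y → y ∈ map suc (upTo h)
    gap⇒∈ {zero} 0∉ = ⊥-elim (0∉ zero∈)
    gap⇒∈ {suc y} y∉ with suc y ≤? h
    ... | yes y<h = ∈-map⁺ suc (∈-upTo⁺ y<h)
    ... | no y≮h  = ⊥-elim (y∉ (h<⇒∈ (≰⇒> y≮h)))

  reflective-interval : Reflective ⟨ intervalGens h ⟩ h
  reflective-interval zero    0<h = inj₁ (zero∈ , gap 0<h ≤-refl)
  reflective-interval (suc z) z<h = inj₂ (gap (s≤s z≤n) (<⇒≤ z<h) , h<⇒∈ (s≤s (m≤n+m h z)))

form⇒reflective : ∀ {S g} → HasGenus S g → ReflectiveForm S g → Reflective S g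
form⇒reflective {S} genus (inj₁ S≐⟨1⟩) with HasGenus-unique S≐⟨1⟩ genus genus-⟨1⟩
... | refl = λ _ ()
form⇒reflective genus (inj₂ (inj₁ (S≐ , g%2≡1))) = Reflective-resp-≐ S≐ (reflective-⟨2,2g+1⟩ g%2≡1)
form⇒reflective genus (inj₂ (inj₂ (inj₁ (S≐ , g%3≡1)))) = Reflective-resp-≐ S≐ (reflective-⟨3,g+1⟩ g%3≡1)
form⇒reflective genus (inj₂ (inj₂ (inj₂ (inj₁ (S≐ , g%3≡2))))) =
  Reflective-resp-≐ S≐ (reflective-⟨3,g+2,2g+1⟩ g%3≡2)
form⇒reflective genus (inj₂ (inj₂ (inj₂ (inj₂ (h , S≐))))) with HasGenus-unique S≐ genus (genus-interval h)
... | refl = Reflective-resp-≐ S≐ (reflective-interval h)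

corollary4p10 : (a d k g : ℕ) → k ≤ a →
    FiniteComplement ⟨ apGens a d k ⟩ →
    HasGenus ⟨ apGens a d k ⟩ g →
    Reflective ⟨ apGens a d k ⟩ g ⇔
      ( (⟨ apGens a d k ⟩ ≐ ⟨ 1 ∷ [] ⟩)
      ⊎ ((⟨ apGens a d k ⟩ ≐ ⟨ 2 ∷ 2 * g + 1 ∷ [] ⟩) × g % 2 ≡ 1)
      ⊎ ((⟨ apGens a d k ⟩ ≐ ⟨ 3 ∷ g + 1 ∷ [] ⟩) × g % 3 ≡ 1)
      ⊎ ((⟨ apGens a d k ⟩ ≐ ⟨ 3 ∷ g + 2 ∷ 2 * g + 1 ∷ [] ⟩) × g % 3 ≡ 2)
      ⊎ (∃ λ h → ⟨ apGens a d k ⟩ ≐ ⟨ map (λ i → h + 1 + i) (upTo (h + 1)) ⟩) )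
corollary4p10 a d k g k≤a fc genus = mk⇔ (reflective-apGens⇒form k≤a fc genus) (form⇒reflective genus)
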